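{- Let $a_1,\ldots,a_k$ be relatively prime positive integers and $j\ge 0$ an integer. If $f_j(a_1,\ldots,a_k)$ is nonzero, then there exist integers $x_2,\ldots,x_k>0$ such that $$f_j(a_1,\ldots,a_k)=\sum_{i=2}^k a_ix_i.$$
   Context: A positive representation of an integer $M$ by a $k$-tuple $(b_1,\ldots,b_k)$ of positive integers is a solution $(x_1,\ldots,x_k)\in\mathbb{Z}_{>0}^k$ of $M=\sum_{i=1}^k b_ix_i$. For relatively prime positive integers $b_1,\ldots,b_k$ and an integer $j\ge0$, $f_j(b_1,\ldots,b_k)$ is the greatest integer $M$ having exactly $j$ positive representations by $(b_1,\ldots,b_k)$, if such a positive integer exists, and $f_j(b_1,\ldots,b_k)=0$ otherwise. -}

module Defs where

open import Data.Nat using (ℕ; _*_; _<_; _≤_)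
open import Data.Nat.Divisibility using (_∣_)
open import Data.Vec using (Vec; zipWith)
open import Data.Vec.Relation.Unary.All using (All)
open import Data.List using (List; sum; length)
open import Data.List.Membership.Propositional using (_∈_)
open import Data.List.Relation.Unary.Unique.Propositional using (Unique)
open import Data.Product using (Σ; _×_)
open import Relation.Binary.PropositionalEquality using (_≡_; _≢_)

dot : ∀ {n} → Vec ℕ n → Vec ℕ n → ℕ
dot b x = Data.Vec.sum (zipWith _*_ b x)

Positive : ∀ {n} → Vec ℕ n → Set
Positive = All (λ v → 0 < v)

RelPrime : ∀ {n} → Vec ℕ n → Set
RelPrime b = ∀ d → All (d ∣_) b → d ≡ 1

PosRep : ∀ {n} → Vec ℕ n → ℕ → Vec ℕ n → Set
PosRep b M x = Positive x × dot b x ≡ M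

ExactlyReps : ∀ {n} → Vec ℕ n → ℕ → ℕ → Set
ExactlyReps {n} b j M =
  Σ (List (Vec ℕ n)) λ L →
    length L ≡ j × Unique L × (∀ x → (x ∈ L → PosRep b M x) × (PosRep b M x → x ∈ L))

-- f_j(b) = M with M ≠ 0: M is a positive integer with exactly j positive
-- representations, and no larger integer has exactly j positive representations.
-- (Integers ≤ 0 have no positive representations and are smaller than M, so
--  quantifying over naturals N > M is the same as over integers.)
IsNonzeroF : ∀ {n} → ℕ → Vec ℕ n → ℕ → Set
IsNonzeroF j b M = 0 < M × ExactlyReps b j M × (∀ N → M < N → ¬E N)
  where
    open import Relation.Nullary using (¬_)
    ¬E : ℕ → Set
    ¬E N = ¬ ExactlyReps b j N

{-# OPTIONS --safe #-}
-- If M were not a positive combination of a₂,…,a_k, every positive representation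
-- of M + a₁ would have x₁ ≥ 2, so lowering x₁ by one is a bijection onto the
-- positive representations of M.  Then M + a₁ > M also has exactly j of them,
-- contradicting the maximality of M.  Positive representability is decidable
-- (bounded search), which turns this contradiction into an explicit witness.
module Submission where

open import Defs
open import Data.Nat
  using (ℕ; zero; suc; _+_; _*_; _∸_; _≤_; _<_; z≤n; s≤s; _≟_; _<?_; _≤?_; >-nonZero)
open import Data.Nat.Properties
open import Data.Vec using (Vec; _∷_; [])
open import Data.Vec.Relation.Unary.All using (_∷_; [])
open import Data.List using (map)
open import Data.List.Membership.Propositional using (_∈_)
open import Data.List.Properties using (length-map)
open import Data.List.Membership.Propositional.Properties using (∈-map⁺; ∈-map⁻)
open import Data.List.Relation.Unary.Unique.Propositional.Properties using (map⁺)
open import Data.Product using (Σ; ∃; _×_; _,_; proj₁; proj₂)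
open import Data.Empty using (⊥-elim)
open import Relation.Nullary using (Dec; ¬_; yes; no)
open import Relation.Nullary.Decidable using (map′; _×-dec_)
open import Relation.Binary.PropositionalEquality using (_≡_; refl; sym; trans; cong; subst)

Representable : ∀ {n} → Vec ℕ n → ℕ → Set
Representable b M = ∃ (PosRep b M)

representable? : ∀ {n} {b : Vec ℕ n} → Positive b → ∀ M → Dec (Representable b M)
representable? [] M =
  map′ (λ 0≡M → [] , [] , 0≡M) (λ { ([] , _ , 0≡M) → 0≡M }) (0 ≟ M)
representable? {b = b ∷ bs} (0<b ∷ pbs) M =
  map′ fromHead toHead
    (anyUpTo? (λ x → (0 <? x) ×-dec ((b * x ≤? M) ×-dec representable? pbs (M ∸ b * x)))
              (suc M))
  where
  fromHead : ∃ (λ x → x < suc M × 0 < x × b * x ≤ M × Representable bs (M ∸ b * x)) →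
             Representable (b ∷ bs) M
  fromHead (x , _ , 0<x , bx≤M , xs , pxs , eq) =
    x ∷ xs , 0<x ∷ pxs , trans (cong (b * x +_) eq) (m+[n∸m]≡n bx≤M)

  toHead : Representable (b ∷ bs) M →
           ∃ (λ x → x < suc M × 0 < x × b * x ≤ M × Representable bs (M ∸ b * x))
  toHead (x ∷ xs , 0<x ∷ pxs , eq) =
    x , s≤s (≤-trans (m≤n*m x b {{>-nonZero 0<b}}) bx≤M) , 0<x , bx≤M , xs , pxs ,
    trans (sym (m+n∸m≡n (b * x) (dot bs xs))) (cong (_∸ b * x) eq)
    where
    bx≤M : b * x ≤ M
    bx≤M = subst (b * x ≤_) eq (m≤m+n (b * x) (dot bs xs))

incHead : ∀ {k} → Vec ℕ (suc k) → Vec ℕ (suc k)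
incHead (x ∷ xs) = suc x ∷ xs

incHead-injective : ∀ {k} {x y : Vec ℕ (suc k)} → incHead x ≡ incHead y → x ≡ y
incHead-injective {x = _ ∷ _} {_ ∷ _} refl = refl

dot-incHead : ∀ {k} a (as : Vec ℕ k) x xs →
              dot (a ∷ as) (incHead (x ∷ xs)) ≡ dot (a ∷ as) (x ∷ xs) + a
dot-incHead a as x xs =
  trans (cong (_+ dot as xs) (*-suc a x)) (trans (+-assoc a (a * x) (dot as xs)) (+-comm a _))

PosRep-incHead : ∀ {k} {a} {as : Vec ℕ k} {M x xs} →
                 PosRep (a ∷ as) M (x ∷ xs) → PosRep (a ∷ as) (M + a) (incHead (x ∷ xs))
PosRep-incHead {a = a} {as} {x = x} {xs} (_ ∷ pxs , eq) =
  s≤s z≤n ∷ pxs , trans (dot-incHead a as x xs) (cong (_+ a) eq)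

dot-incHead⁻ : ∀ {k} {a} {as : Vec ℕ k} {M} x xs →
               dot (a ∷ as) (incHead (x ∷ xs)) ≡ M + a → dot (a ∷ as) (x ∷ xs) ≡ M
dot-incHead⁻ {a = a} {as} {M} x xs eq =
  +-cancelʳ-≡ a (dot (a ∷ as) (x ∷ xs)) M (trans (sym (dot-incHead a as x xs)) eq)

ExactlyReps-+head : ∀ {k} {a} {as : Vec ℕ k} {j M} → ¬ Representable as M →
                    ExactlyReps (a ∷ as) j M → ExactlyReps (a ∷ as) j (M + a)
ExactlyReps-+head {a = a} {as} {M = M} ¬rep (L , len , unique , reps) =
  map incHead L , trans (length-map incHead L) len , map⁺ incHead-injective unique ,
  λ y → sound , complete y
  where
  sound : ∀ {y} → y ∈ map incHead L → PosRep (a ∷ as) (M + a) y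
  sound y∈ with ∈-map⁻ incHead y∈
  ... | x ∷ xs , x∈L , refl = PosRep-incHead {as = as} (proj₁ (reps (x ∷ xs)) x∈L)

  complete : ∀ y → PosRep (a ∷ as) (M + a) y → y ∈ map incHead L
  complete (suc zero ∷ ys) (_ ∷ pys , eq) = ⊥-elim (¬rep (ys , pys , dot-tail))
    where
    dot-tail : dot as ys ≡ M
    dot-tail = trans (cong (_+ dot as ys) (sym (*-zeroʳ a))) (dot-incHead⁻ {as = as} 0 ys eq)
  complete (suc (suc x) ∷ ys) (_ ∷ pys , eq) =
    ∈-map⁺ incHead (proj₂ (reps (suc x ∷ ys))
                           (s≤s z≤n ∷ pys , dot-incHead⁻ {as = as} (suc x) ys eq))

-- Coprimality only ensures that f_j is finite; the argument does not need it.
lemma1 : (k : ℕ) (a₁ : ℕ) (as : Vec ℕ k) (j M : ℕ) →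
         Positive (a₁ ∷ as) → RelPrime (a₁ ∷ as) →
         IsNonzeroF j (a₁ ∷ as) M →
         Σ (Vec ℕ k) λ xs → Positive xs × M ≡ dot as xs
lemma1 k a₁ as j M (0<a₁ ∷ pas) _ (_ , reps , maximal) with representable? pas M
... | yes (xs , pxs , eq) = xs , pxs , sym eq
... | no ¬rep = ⊥-elim (maximal (M + a₁) (m<m+n M 0<a₁) (ExactlyReps-+head ¬rep reps))
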